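{- For all integers $n \geq 1$ and $r \geq 1$, \[ S_{2r+1} = \frac{r+1}{2}\,S_{r}^2 - \sum_{j=1}^{\lfloor r/2\rfloor} B_{2j} \binom{r+1}{2j} S_{2r+1-2j}, \] where $S_k = \sum_{i=1}^{n} i^k$ and $B_m$ denotes the $m$-th Bernoulli number.
   Context: For integers $n \geq 1$ and $k \geq 0$, $S_k = 1^k + 2^k + \cdots + n^k$. The Bernoulli numbers $B_m$ are defined by $\frac{t}{e^t-1} = \sum_{m\ge 0} B_m \frac{t^m}{m!}$ (so $B_0=1$, $B_2 = 1/6$, $B_4=-1/30$, and only even-indexed Bernoulli numbers occur in the formula). An empty sum is zero. -}

module Defs where

open import Data.Nat as ℕ using (ℕ; zero; suc; _^_)
open import Data.Nat.Combinatorics using (_C_)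
open import Data.Integer as ℤ using (ℤ; +_)
open import Data.Rational as ℚ using (ℚ; _+_; _*_; -_; _/_)
open import Data.List using (List; []; _∷_; _++_; length; lookup; reverse)
open import Data.Fin using (Fin)

ι : ℕ → ℚ
ι n = (+ n) / 1

-- Σ_{i=a}^{b} f i  (empty, i.e. zero, when b < a); written as Σ over i = 0 .. len-1 shifted
-- ΣFrom a len f = f a + f (a+1) + ... + f (a + len - 1)
ΣFrom : ℕ → ℕ → (ℕ → ℚ) → ℚ
ΣFrom a zero    f = ℚ.0ℚ
ΣFrom a (suc l) f = f a + ΣFrom (suc a) l f

S : ℕ → ℕ → ℚ
S n k = ΣFrom 1 n (λ i → ι (i ^ k))

-- Bernoulli numbers with the convention t/(e^t-1) = Σ B_m t^m/m!  (so B_1 = -1/2).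
-- Comparing coefficients of t^{m+1} in t = (e^t - 1) Σ B_m t^m/m! gives
--   B_0 = 1,   Σ_{k=0}^{m} C(m+1,k) B_k = 0   (m ≥ 1),
-- i.e.  B_m = -(1/(m+1)) Σ_{k=0}^{m-1} C(m+1,k) B_k.
-- bernList m = [B_0, B_1, ..., B_{m}]  (computed iteratively, in order)
private
  nextB : List ℚ → ℚ
  nextB bs = - (((+ 1) / suc m) * sumC 0 bs)
    where
    m = length bs
    sumC : ℕ → List ℚ → ℚ
    sumC k []       = ℚ.0ℚ
    sumC k (b ∷ bs′) = ι (suc m C k) * b + sumC (suc k) bs′

bernList : ℕ → List ℚ
bernList zero    = ℚ.1ℚ ∷ []
bernList (suc m) = bernList m ++ (nextB (bernList m) ∷ [])

B : ℕ → ℚ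
B m = last (bernList m)
  where
  last : List ℚ → ℚ
  last []       = ℚ.0ℚ
  last (x ∷ []) = x
  last (x ∷ y ∷ xs) = last (y ∷ xs)

-- Read sequences as exponential generating functions. The recurrence defining
-- the Bernoulli numbers says B(t) eᵗ = B(t) + t. This equation has only one
-- solution (only zero is fixed by multiplication with eᵗ), and t ↦ B(-t) - t
-- solves it too; hence B(-t) = B(t) + t and the odd Bₖ with k ≥ 3 vanish.
-- Multiplying by e^{yt} and comparing y with y + 1 gives Faulhaber's formula
-- (r+1) Sᵣ(n) = Σₖ C(r+1,k) Bₖ (n+1)^{r+1-k} - B_{r+1}. The identity then follows
-- by induction on n: once (r+1) Sᵣ(n) is rewritten by Faulhaber's formula, both
-- sides grow by (n+1)^{2r+1} from n to n + 1. At n = 0 both sides vanish.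
module Submission where

open import Defs
open import Data.Nat as ℕ using (ℕ; suc; _≥_; _/_)
open import Data.Nat.Combinatorics using (_C_)
open import Data.Integer using (+_)
open import Data.Rational as ℚ using (ℚ; _+_; _-_; _*_)
open import Relation.Binary.PropositionalEquality using (_≡_)

open import Algebra.Bundles using (CommutativeRing)
open import Data.Nat using (zero; _<_; _∸_; z≤n; s≤s)
import Data.Nat.Properties as ℕ
open import Data.Nat.Combinatorics using (k>n⇒nCk≡0; nCk+nC[k+1]≡[n+1]C[k+1]; nCk≡nC[n∸k]; nCn≡1; nC1≡n)
open import Data.Nat.Induction using (<-rec)
import Data.Nat.DivMod as ℕD
open import Data.Nat.Divisibility using (divides-refl)
import Data.Integer as ℤ
import Data.Integer.Tactic.RingSolver as ℤ-Solver
import Data.Nat.Tactic.RingSolver as ℕ-Solver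
open import Data.Rational using (-_; 0ℚ; 1ℚ; ½)
open import Data.Rational.Properties
import Data.Rational.Unnormalised as ℚᵘ
import Data.Rational.Unnormalised.Properties as ℚᵘ
open import Relation.Binary.PropositionalEquality
open import Relation.Nullary.Decidable using (dec⇒maybe)
open import Function using (_∘_)
open import Data.List using (List; []; _∷_; _++_; length)
open import Tactic.RingSolver.Core.AlmostCommutativeRing using (AlmostCommutativeRing; fromCommutativeRing)
open import Tactic.RingSolver using (solve-∀)

open import Algebra.Properties.Semiring.Exp (CommutativeRing.semiring +-*-commutativeRing)
  using (_^_; ^-assocʳ; ^-homo-*)
open import Algebra.Properties.Semiring.Mult (CommutativeRing.semiring +-*-commutativeRing)
  using (_×_; ×-homo-+; ×1-homo-*)

ℚ-ring : AlmostCommutativeRing _ _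
ℚ-ring = fromCommutativeRing +-*-commutativeRing (λ x → dec⇒maybe (0ℚ ≟ x))

fromℚᵘ-homo-+ : ∀ p q → ℚ.fromℚᵘ (p ℚᵘ.+ q) ≡ ℚ.fromℚᵘ p + ℚ.fromℚᵘ q
fromℚᵘ-homo-+ p q = toℚᵘ-injective (ℚᵘ.≃-trans (toℚᵘ-fromℚᵘ (p ℚᵘ.+ q))
  (ℚᵘ.≃-trans (ℚᵘ.+-cong (ℚᵘ.≃-sym (toℚᵘ-fromℚᵘ p)) (ℚᵘ.≃-sym (toℚᵘ-fromℚᵘ q)))
    (ℚᵘ.≃-sym (toℚᵘ-homo-+ (ℚ.fromℚᵘ p) (ℚ.fromℚᵘ q)))))

fromℚᵘ-homo-* : ∀ p q → ℚ.fromℚᵘ (p ℚᵘ.* q) ≡ ℚ.fromℚᵘ p * ℚ.fromℚᵘ q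
fromℚᵘ-homo-* p q = toℚᵘ-injective (ℚᵘ.≃-trans (toℚᵘ-fromℚᵘ (p ℚᵘ.* q))
  (ℚᵘ.≃-trans (ℚᵘ.*-cong (ℚᵘ.≃-sym (toℚᵘ-fromℚᵘ p)) (ℚᵘ.≃-sym (toℚᵘ-fromℚᵘ q)))
    (ℚᵘ.≃-sym (toℚᵘ-homo-* (ℚ.fromℚᵘ p) (ℚ.fromℚᵘ q)))))

-- ι n is definitionally fromℚᵘ (mkℚᵘ (+ n) 0), so identities for ι reduce to
-- cross-multiplied integer identities.
ι-suc : ∀ n → ι (suc n) ≡ 1ℚ + ι n
ι-suc n = trans (fromℚᵘ-cong {ℚᵘ.mkℚᵘ (+ suc n) 0} {one ℚᵘ.+ ℚᵘ.mkℚᵘ (+ n) 0} (ℚᵘ.*≡* (cross (+ n))))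
                (fromℚᵘ-homo-+ one (ℚᵘ.mkℚᵘ (+ n) 0))
  where
  one = ℚᵘ.mkℚᵘ (+ 1) 0
  cross : ∀ x → (+ 1 ℤ.+ x) ℤ.* + 1 ≡ (+ 1 ℤ.* + 1 ℤ.+ x ℤ.* + 1) ℤ.* + 1
  cross = ℤ-Solver.solve-∀

ι-*-inverse : ∀ k → ι (suc k) * (+ 1 ℚ./ suc k) ≡ 1ℚ
ι-*-inverse k = trans (sym (fromℚᵘ-homo-* (ℚᵘ.mkℚᵘ (+ suc k) 0) (ℚᵘ.mkℚᵘ (+ 1) k)))
  (fromℚᵘ-cong {ℚᵘ.mkℚᵘ (+ suc k) 0 ℚᵘ.* ℚᵘ.mkℚᵘ (+ 1) k} {ℚᵘ.1ℚᵘ} (ℚᵘ.*≡* (cross (+ suc k))))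
  where
  cross : ∀ x → (x ℤ.* + 1) ℤ.* + 1 ≡ + 1 ℤ.* (+ 1 ℤ.* x)
  cross = ℤ-Solver.solve-∀

/2≡*½ : ∀ m → + m ℚ./ 2 ≡ ι m * ½
/2≡*½ m = trans (fromℚᵘ-cong {ℚᵘ.mkℚᵘ (+ m) 1} {ℚᵘ.mkℚᵘ (+ m) 0 ℚᵘ.* ℚᵘ.mkℚᵘ (+ 1) 1} (ℚᵘ.*≡* (cross (+ m))))
  (fromℚᵘ-homo-* (ℚᵘ.mkℚᵘ (+ m) 0) (ℚᵘ.mkℚᵘ (+ 1) 1))
  where
  cross : ∀ x → x ℤ.* + 2 ≡ (x ℤ.* + 1) ℤ.* + 2
  cross = ℤ-Solver.solve-∀

ι≡×1 : ∀ n → ι n ≡ n × 1ℚ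
ι≡×1 zero    = refl
ι≡×1 (suc n) = trans (ι-suc n) (cong (_+_ 1ℚ) (ι≡×1 n))

ι-homo-+ : ∀ m n → ι (m ℕ.+ n) ≡ ι m + ι n
ι-homo-+ m n = trans (ι≡×1 (m ℕ.+ n)) (trans (×-homo-+ 1ℚ m n) (sym (cong₂ _+_ (ι≡×1 m) (ι≡×1 n))))

ι-homo-* : ∀ m n → ι (m ℕ.* n) ≡ ι m * ι n
ι-homo-* m n = trans (ι≡×1 (m ℕ.* n)) (trans (×1-homo-* m n) (sym (cong₂ _*_ (ι≡×1 m) (ι≡×1 n))))

ι-homo-^ : ∀ m k → ι (m ℕ.^ k) ≡ ι m ^ k
ι-homo-^ m zero    = refl
ι-homo-^ m (suc k) = trans (ι-homo-* m (m ℕ.^ k)) (cong (ι m *_) (ι-homo-^ m k))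

1^n≡1 : ∀ n → 1ℚ ^ n ≡ 1ℚ
1^n≡1 zero    = refl
1^n≡1 (suc n) = trans (*-identityˡ (1ℚ ^ n)) (1^n≡1 n)

-1^[1+2n]≡-1 : ∀ n → (- 1ℚ) ^ suc (2 ℕ.* n) ≡ - 1ℚ
-1^[1+2n]≡-1 n = trans (cong (- 1ℚ *_) (trans (sym (^-assocʳ (- 1ℚ) 2 n)) (1^n≡1 n))) (*-identityʳ (- 1ℚ))

[1+n]Cn≡1+n : ∀ n → suc n C n ≡ suc n
[1+n]Cn≡1+n n = trans (nCk≡nC[n∸k] (ℕ.n≤1+n n)) (trans (cong (suc n C_) (ℕ.m+n∸n≡m 1 n)) (nC1≡n (suc n)))

*-cancelˡ-ι-suc : ∀ k x → ι (suc k) * x ≡ 0ℚ → x ≡ 0ℚ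
*-cancelˡ-ι-suc k x eq = begin
  x                        ≡⟨ sym (*-identityˡ x) ⟩
  1ℚ * x                   ≡⟨ cong (_* x) (sym (trans (*-comm h (ι (suc k))) (ι-*-inverse k))) ⟩
  (h * ι (suc k)) * x      ≡⟨ *-assoc h (ι (suc k)) x ⟩
  h * (ι (suc k) * x)      ≡⟨ cong (_*_ h) eq ⟩
  h * 0ℚ                   ≡⟨ *-zeroʳ h ⟩
  0ℚ                       ∎
  where
  open ≡-Reasoning
  h = + 1 ℚ./ suc k

ΣFrom-cong : ∀ a l {f g : ℕ → ℚ} → (∀ i → i < l → f (a ℕ.+ i) ≡ g (a ℕ.+ i)) → ΣFrom a l f ≡ ΣFrom a l g
ΣFrom-cong a zero    eq = refl
ΣFrom-cong a (suc l) {f} {g} eq = cong₂ _+_ head (ΣFrom-cong (suc a) l tail)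
  where
  head : f a ≡ g a
  head = subst (λ i → f i ≡ g i) (ℕ.+-identityʳ a) (eq 0 (s≤s z≤n))
  tail : ∀ i → i < l → f (suc a ℕ.+ i) ≡ g (suc a ℕ.+ i)
  tail i i<l = subst (λ j → f j ≡ g j) (ℕ.+-suc a i) (eq (suc i) (s≤s i<l))

ΣFrom-init-last : ∀ a l (f : ℕ → ℚ) → ΣFrom a (suc l) f ≡ ΣFrom a l f + f (a ℕ.+ l)
ΣFrom-init-last a zero f = begin
  f a + 0ℚ           ≡⟨ +-comm (f a) 0ℚ ⟩
  0ℚ + f a           ≡⟨ cong (λ i → 0ℚ + f i) (sym (ℕ.+-identityʳ a)) ⟩
  0ℚ + f (a ℕ.+ 0)   ∎
  where open ≡-Reasoning
ΣFrom-init-last a (suc l) f = begin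
  f a + ΣFrom (suc a) (suc l) f                      ≡⟨ cong (_+_ (f a)) (ΣFrom-init-last (suc a) l f) ⟩
  f a + (ΣFrom (suc a) l f + f (suc a ℕ.+ l))        ≡⟨ sym (+-assoc (f a) _ _) ⟩
  (f a + ΣFrom (suc a) l f) + f (suc a ℕ.+ l)        ≡⟨ cong (λ i → (f a + ΣFrom (suc a) l f) + f i) (sym (ℕ.+-suc a l)) ⟩
  (f a + ΣFrom (suc a) l f) + f (a ℕ.+ suc l)        ∎
  where open ≡-Reasoning

ΣFrom-shift : ∀ a l (f : ℕ → ℚ) → ΣFrom (suc a) l f ≡ ΣFrom a l (λ i → f (suc i))
ΣFrom-shift a zero    f = refl
ΣFrom-shift a (suc l) f = cong (_+_ (f (suc a))) (ΣFrom-shift (suc a) l f)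

ΣFrom-distrib-+ : ∀ a l (f g : ℕ → ℚ) → ΣFrom a l (λ i → f i + g i) ≡ ΣFrom a l f + ΣFrom a l g
ΣFrom-distrib-+ a zero    f g = refl
ΣFrom-distrib-+ a (suc l) f g =
  trans (cong (_+_ (f a + g a)) (ΣFrom-distrib-+ (suc a) l f g))
        (interchange (f a) (g a) (ΣFrom (suc a) l f) (ΣFrom (suc a) l g))
  where
  interchange : ∀ w x y z → (w + x) + (y + z) ≡ (w + y) + (x + z)
  interchange = solve-∀ ℚ-ring

*-distribˡ-ΣFrom : ∀ c a l (f : ℕ → ℚ) → ΣFrom a l (λ i → c * f i) ≡ c * ΣFrom a l f
*-distribˡ-ΣFrom c a zero    f = sym (*-zeroʳ c)
*-distribˡ-ΣFrom c a (suc l) f =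
  trans (cong (_+_ (c * f a)) (*-distribˡ-ΣFrom c (suc a) l f)) (sym (*-distribˡ-+ c (f a) _))

ΣFrom-zero : ∀ a l → ΣFrom a l (λ _ → 0ℚ) ≡ 0ℚ
ΣFrom-zero a zero    = refl
ΣFrom-zero a (suc l) = trans (+-identityˡ _) (ΣFrom-zero (suc a) l)

data Parity : ℕ → Set where
  even : ∀ L → Parity (L ℕ.* 2)
  odd  : ∀ L → Parity (suc (L ℕ.* 2))

parity : ∀ n → Parity n
parity zero = even 0
parity (suc n) with parity n
... | even L = odd L
... | odd L  = even (suc L)

ΣFrom-pairs : ∀ (h : ℕ → ℚ) → (∀ i → h (suc (2 ℕ.* suc i)) ≡ 0ℚ) →
              ∀ a L → ΣFrom (2 ℕ.* suc a) (L ℕ.* 2) h ≡ ΣFrom (suc a) L (λ j → h (2 ℕ.* j))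
ΣFrom-pairs h h-odd a zero    = refl
ΣFrom-pairs h h-odd a (suc L) = begin
  h s + (h (suc s) + ΣFrom (suc (suc s)) (L ℕ.* 2) h)   ≡⟨ cong (λ x → h s + (x + ΣFrom (suc (suc s)) (L ℕ.* 2) h)) (h-odd a) ⟩
  h s + (0ℚ + ΣFrom (suc (suc s)) (L ℕ.* 2) h)          ≡⟨ cong (_+_ (h s)) (+-identityˡ _) ⟩
  h s + ΣFrom (suc (suc s)) (L ℕ.* 2) h                 ≡⟨ cong (λ i → h s + ΣFrom i (L ℕ.* 2) h) (next a) ⟩
  h s + ΣFrom (2 ℕ.* suc (suc a)) (L ℕ.* 2) h           ≡⟨ cong (_+_ (h s)) (ΣFrom-pairs h h-odd (suc a) L) ⟩
  h s + ΣFrom (suc (suc a)) L (λ j → h (2 ℕ.* j))       ∎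
  where
  open ≡-Reasoning
  s = 2 ℕ.* suc a
  next : ∀ a → suc (suc (2 ℕ.* suc a)) ≡ 2 ℕ.* suc (suc a)
  next = ℕ-Solver.solve-∀

ΣFrom-evens : ∀ (h : ℕ → ℚ) → (∀ i → h (suc (2 ℕ.* suc i)) ≡ 0ℚ) →
              ∀ r′ → ΣFrom 2 r′ h ≡ ΣFrom 1 (suc r′ / 2) (λ j → h (2 ℕ.* j))
ΣFrom-evens h h-odd r′ with parity r′
... | even L = trans (ΣFrom-pairs h h-odd 0 L) (cong (λ m → ΣFrom 1 m (λ j → h (2 ℕ.* j))) (sym half))
  where
  half : suc (L ℕ.* 2) / 2 ≡ L
  half = trans (ℕD.+-distrib-/-∣ʳ 1 {d = 2} (divides-refl L)) (ℕD.m*n/n≡m L 2)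
... | odd L = begin
  ΣFrom 2 (suc (L ℕ.* 2)) h                                   ≡⟨ ΣFrom-init-last 2 (L ℕ.* 2) h ⟩
  ΣFrom 2 (L ℕ.* 2) h + h (2 ℕ.+ L ℕ.* 2)                     ≡⟨ cong₂ _+_ (ΣFrom-pairs h h-odd 0 L) (cong h (last L)) ⟩
  ΣFrom 1 L (λ j → h (2 ℕ.* j)) + h (2 ℕ.* suc L)             ≡⟨ sym (ΣFrom-init-last 1 L (λ j → h (2 ℕ.* j))) ⟩
  ΣFrom 1 (suc L) (λ j → h (2 ℕ.* j))                         ≡⟨ cong (λ m → ΣFrom 1 m (λ j → h (2 ℕ.* j))) (sym (ℕD.m*n/n≡m (suc L) 2)) ⟩
  ΣFrom 1 (suc L ℕ.* 2 / 2) (λ j → h (2 ℕ.* j))               ∎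
  where
  open ≡-Reasoning
  last : ∀ L → 2 ℕ.+ L ℕ.* 2 ≡ 2 ℕ.* suc L
  last = ℕ-Solver.solve-∀

-- Exponential generating functions

-- A sequence f stands for Σ f k tᵏ/k!: then ∂ is d/dt, δ₀ is 1, δ₁ is t,
-- exp x is e^{xt} and dilate x f is f(xt).
Seq : Set
Seq = ℕ → ℚ

∂ : Seq → Seq
∂ f k = f (suc k)

infixl 6 _⊕_ _⊖_
infixr 7 _·_

_⊕_ : Seq → Seq → Seq
(f ⊕ g) k = f k + g k

_⊖_ : Seq → Seq → Seq
(f ⊖ g) k = f k - g k

_·_ : ℚ → Seq → Seq
(c · f) k = c * f k

0ˢ : Seq
0ˢ _ = 0ℚ

δ₀ : Seq
δ₀ zero    = 1ℚ
δ₀ (suc _) = 0ℚ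

δ₁ : Seq
δ₁ zero    = 0ℚ
δ₁ (suc k) = δ₀ k

exp : ℚ → Seq
exp x k = x ^ k

dilate : ℚ → Seq → Seq
dilate x f k = x ^ k * f k

-- The product is defined by the Leibniz rule for ∂; ⋆-binomial shows that it
-- is the binomial convolution.
infixl 7 _⋆_
_⋆_ : Seq → Seq → Seq
(f ⋆ g) zero    = f 0 * g 0
(f ⋆ g) (suc n) = (∂ f ⋆ g) n + (f ⋆ ∂ g) n

⋆-cong : ∀ {f f′ g g′} → f ≗ f′ → g ≗ g′ → f ⋆ g ≗ f′ ⋆ g′
⋆-cong f≗f′ g≗g′ zero    = cong₂ _*_ (f≗f′ 0) (g≗g′ 0)
⋆-cong f≗f′ g≗g′ (suc n) = cong₂ _+_ (⋆-cong (f≗f′ ∘ suc) g≗g′ n) (⋆-cong f≗f′ (g≗g′ ∘ suc) n)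

⋆-comm : ∀ f g → f ⋆ g ≗ g ⋆ f
⋆-comm f g zero    = *-comm (f 0) (g 0)
⋆-comm f g (suc n) = trans (cong₂ _+_ (⋆-comm (∂ f) g n) (⋆-comm f (∂ g) n)) (+-comm ((g ⋆ ∂ f) n) ((∂ g ⋆ f) n))

⋆-distribʳ-⊕ : ∀ f g h → (f ⊕ g) ⋆ h ≗ f ⋆ h ⊕ g ⋆ h
⋆-distribʳ-⊕ f g h zero    = *-distribʳ-+ (h 0) (f 0) (g 0)
⋆-distribʳ-⊕ f g h (suc n) =
  trans (cong₂ _+_ (⋆-distribʳ-⊕ (∂ f) (∂ g) h n) (⋆-distribʳ-⊕ f g (∂ h) n))
        (interchange ((∂ f ⋆ h) n) ((∂ g ⋆ h) n) ((f ⋆ ∂ h) n) ((g ⋆ ∂ h) n))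
  where
  interchange : ∀ w x y z → (w + x) + (y + z) ≡ (w + y) + (x + z)
  interchange = solve-∀ ℚ-ring

⋆-distribˡ-⊕ : ∀ f g h → h ⋆ (f ⊕ g) ≗ h ⋆ f ⊕ h ⋆ g
⋆-distribˡ-⊕ f g h n =
  trans (⋆-comm h (f ⊕ g) n) (trans (⋆-distribʳ-⊕ f g h n) (cong₂ _+_ (⋆-comm f h n) (⋆-comm g h n)))

⋆-distribʳ-⊖ : ∀ f g h → (f ⊖ g) ⋆ h ≗ f ⋆ h ⊖ g ⋆ h
⋆-distribʳ-⊖ f g h zero    = distrib (f 0) (g 0) (h 0)
  where
  distrib : ∀ x y z → (x - y) * z ≡ x * z - y * z
  distrib = solve-∀ ℚ-ring
⋆-distribʳ-⊖ f g h (suc n) =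
  trans (cong₂ _+_ (⋆-distribʳ-⊖ (∂ f) (∂ g) h n) (⋆-distribʳ-⊖ f g (∂ h) n))
        (interchange ((∂ f ⋆ h) n) ((∂ g ⋆ h) n) ((f ⋆ ∂ h) n) ((g ⋆ ∂ h) n))
  where
  interchange : ∀ w x y z → (w - x) + (y - z) ≡ (w + y) - (x + z)
  interchange = solve-∀ ℚ-ring

·-⋆ : ∀ c f g → (c · f) ⋆ g ≗ c · (f ⋆ g)
·-⋆ c f g zero    = *-assoc c (f 0) (g 0)
·-⋆ c f g (suc n) =
  trans (cong₂ _+_ (·-⋆ c (∂ f) g n) (·-⋆ c f (∂ g) n)) (sym (*-distribˡ-+ c ((∂ f ⋆ g) n) ((f ⋆ ∂ g) n)))

⋆-· : ∀ c f g → f ⋆ (c · g) ≗ c · (f ⋆ g)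
⋆-· c f g n = trans (⋆-comm f (c · g) n) (trans (·-⋆ c g f n) (cong (_*_ c) (⋆-comm g f n)))

⋆-assoc : ∀ f g h → (f ⋆ g) ⋆ h ≗ f ⋆ (g ⋆ h)
⋆-assoc f g h zero    = *-assoc (f 0) (g 0) (h 0)
⋆-assoc f g h (suc n) = begin
  ((∂ f ⋆ g ⊕ f ⋆ ∂ g) ⋆ h) n + ((f ⋆ g) ⋆ ∂ h) n
    ≡⟨ cong (_+ ((f ⋆ g) ⋆ ∂ h) n) (⋆-distribʳ-⊕ (∂ f ⋆ g) (f ⋆ ∂ g) h n) ⟩
  (((∂ f ⋆ g) ⋆ h) n + ((f ⋆ ∂ g) ⋆ h) n) + ((f ⋆ g) ⋆ ∂ h) n
    ≡⟨ cong₂ _+_ (cong₂ _+_ (⋆-assoc (∂ f) g h n) (⋆-assoc f (∂ g) h n)) (⋆-assoc f g (∂ h) n) ⟩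
  ((∂ f ⋆ (g ⋆ h)) n + (f ⋆ (∂ g ⋆ h)) n) + (f ⋆ (g ⋆ ∂ h)) n
    ≡⟨ +-assoc ((∂ f ⋆ (g ⋆ h)) n) _ _ ⟩
  (∂ f ⋆ (g ⋆ h)) n + ((f ⋆ (∂ g ⋆ h)) n + (f ⋆ (g ⋆ ∂ h)) n)
    ≡⟨ cong (_+_ ((∂ f ⋆ (g ⋆ h)) n)) (sym (⋆-distribˡ-⊕ (∂ g ⋆ h) (g ⋆ ∂ h) f n)) ⟩
  (∂ f ⋆ (g ⋆ h)) n + (f ⋆ (∂ g ⋆ h ⊕ g ⋆ ∂ h)) n
    ∎
  where open ≡-Reasoning

⋆-zeroˡ : ∀ g → 0ˢ ⋆ g ≗ 0ˢ
⋆-zeroˡ g zero    = *-zeroˡ (g 0)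
⋆-zeroˡ g (suc n) = trans (cong₂ _+_ (⋆-zeroˡ g n) (⋆-zeroˡ (∂ g) n)) (+-identityˡ 0ℚ)

⋆-identityˡ : ∀ g → δ₀ ⋆ g ≗ g
⋆-identityˡ g zero    = *-identityˡ (g 0)
⋆-identityˡ g (suc n) = trans (cong₂ _+_ (⋆-zeroˡ g n) (⋆-identityˡ (∂ g) n)) (+-identityˡ (g (suc n)))

⋆-identityʳ : ∀ f → f ⋆ δ₀ ≗ f
⋆-identityʳ f n = trans (⋆-comm f δ₀ n) (⋆-identityˡ f n)

δ₁-⋆ : ∀ g n → (δ₁ ⋆ g) (suc n) ≡ ι (suc n) * g n
δ₁-⋆ g zero = begin
  (δ₀ ⋆ g) 0 + 0ℚ * g 1 ≡⟨ cong₂ _+_ (⋆-identityˡ g 0) (*-zeroˡ (g 1)) ⟩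
  g 0 + 0ℚ              ≡⟨ +-identityʳ (g 0) ⟩
  g 0                   ≡⟨ sym (*-identityˡ (g 0)) ⟩
  1ℚ * g 0              ∎
  where open ≡-Reasoning
δ₁-⋆ g (suc n) = begin
  (δ₀ ⋆ g) (suc n) + (δ₁ ⋆ ∂ g) (suc n) ≡⟨ cong₂ _+_ (⋆-identityˡ g (suc n)) (δ₁-⋆ (∂ g) n) ⟩
  g (suc n) + ι (suc n) * g (suc n)     ≡⟨ factor (ι (suc n)) (g (suc n)) ⟩
  (1ℚ + ι (suc n)) * g (suc n)          ≡⟨ cong (_* g (suc n)) (sym (ι-suc (suc n))) ⟩
  ι (suc (suc n)) * g (suc n)           ∎
  where
  open ≡-Reasoning
  factor : ∀ a x → x + a * x ≡ (1ℚ + a) * x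
  factor = solve-∀ ℚ-ring

exp-⋆ : ∀ x y → exp x ⋆ exp y ≗ exp (x + y)
exp-⋆ x y zero    = *-identityˡ 1ℚ
exp-⋆ x y (suc n) = begin
  ((x · exp x) ⋆ exp y) n + (exp x ⋆ (y · exp y)) n
    ≡⟨ cong₂ _+_ (·-⋆ x (exp x) (exp y) n) (⋆-· y (exp x) (exp y) n) ⟩
  x * (exp x ⋆ exp y) n + y * (exp x ⋆ exp y) n
    ≡⟨ sym (*-distribʳ-+ ((exp x ⋆ exp y) n) x y) ⟩
  (x + y) * (exp x ⋆ exp y) n
    ≡⟨ cong (_*_ (x + y)) (exp-⋆ x y n) ⟩
  (x + y) * (x + y) ^ n
    ∎
  where open ≡-Reasoning

exp-0 : exp 0ℚ ≗ δ₀
exp-0 zero    = refl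
exp-0 (suc k) = *-zeroˡ (0ℚ ^ k)

dilate-⋆ : ∀ x f g → dilate x f ⋆ dilate x g ≗ dilate x (f ⋆ g)
dilate-⋆ x f g zero    = regroup (f 0) (g 0)
  where
  regroup : ∀ a b → (1ℚ * a) * (1ℚ * b) ≡ 1ℚ * (a * b)
  regroup = solve-∀ ℚ-ring
dilate-⋆ x f g (suc n) = begin
  (∂ (dilate x f) ⋆ dilate x g) n + (dilate x f ⋆ ∂ (dilate x g)) n
    ≡⟨ cong₂ _+_ (⋆-cong (∂-dilate f) (λ _ → refl) n) (⋆-cong (λ _ → refl) (∂-dilate g) n) ⟩
  ((x · dilate x (∂ f)) ⋆ dilate x g) n + (dilate x f ⋆ (x · dilate x (∂ g))) n
    ≡⟨ cong₂ _+_ (·-⋆ x (dilate x (∂ f)) (dilate x g) n) (⋆-· x (dilate x f) (dilate x (∂ g)) n) ⟩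
  x * (dilate x (∂ f) ⋆ dilate x g) n + x * (dilate x f ⋆ dilate x (∂ g)) n
    ≡⟨ cong₂ (λ u v → x * u + x * v) (dilate-⋆ x (∂ f) g n) (dilate-⋆ x f (∂ g) n) ⟩
  x * (x ^ n * (∂ f ⋆ g) n) + x * (x ^ n * (f ⋆ ∂ g) n)
    ≡⟨ regroup x (x ^ n) ((∂ f ⋆ g) n) ((f ⋆ ∂ g) n) ⟩
  x ^ suc n * (f ⋆ g) (suc n)
    ∎
  where
  open ≡-Reasoning
  ∂-dilate : ∀ h → ∂ (dilate x h) ≗ x · dilate x (∂ h)
  ∂-dilate h k = *-assoc x (x ^ k) (h (suc k))
  regroup : ∀ x p a b → x * (p * a) + x * (p * b) ≡ (x * p) * (a + b)
  regroup = solve-∀ ℚ-ring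

dilate-δ₁ : ∀ k → (- 1ℚ) ^ k * δ₁ k ≡ - δ₁ k
dilate-δ₁ zero          = refl
dilate-δ₁ (suc zero)    = refl
dilate-δ₁ (suc (suc k)) = *-zeroʳ ((- 1ℚ) ^ suc (suc k))

exp≗dilate-exp1 : ∀ x → exp x ≗ dilate x (exp 1ℚ)
exp≗dilate-exp1 x k = sym (trans (cong (_*_ (x ^ k)) (1^n≡1 k)) (*-identityʳ (x ^ k)))

exp-neg⋆exp : ∀ x → exp (- x) ⋆ exp x ≗ δ₀
exp-neg⋆exp x k = trans (exp-⋆ (- x) x k) (trans (cong (_^ k) (+-inverseˡ x)) (exp-0 k))

⋆-exp-cancel : ∀ x f → f ⋆ exp (- x) ⋆ exp x ≗ f
⋆-exp-cancel x f k = begin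
  (f ⋆ exp (- x) ⋆ exp x) k       ≡⟨ ⋆-assoc f (exp (- x)) (exp x) k ⟩
  (f ⋆ (exp (- x) ⋆ exp x)) k     ≡⟨ ⋆-cong (λ _ → refl) (exp-neg⋆exp x) k ⟩
  (f ⋆ δ₀) k                      ≡⟨ ⋆-identityʳ f k ⟩
  f k                             ∎
  where open ≡-Reasoning

⋆-binomial : ∀ f g n → (f ⋆ g) n ≡ ΣFrom 0 (suc n) (λ k → ι (n C k) * (f k * g (n ∸ k)))
⋆-binomial f g zero    = sym (trans (+-identityʳ _) (*-identityˡ _))
⋆-binomial f g (suc n) = begin
  (∂ f ⋆ g) n + (f ⋆ ∂ g) n
    ≡⟨ cong₂ _+_ (⋆-binomial (∂ f) g n) (⋆-binomial f (∂ g) n) ⟩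
  ΣFrom 0 (suc n) A + (R 0 + ΣFrom 1 n R)
    ≡⟨ cong (λ s → ΣFrom 0 (suc n) A + (R 0 + s)) (trans (ΣFrom-shift 0 n R) (ΣFrom-cong 0 n shifted)) ⟩
  ΣFrom 0 (suc n) A + (R 0 + ΣFrom 0 n P)
    ≡⟨ cong (λ s → ΣFrom 0 (suc n) A + (R 0 + s)) P-last ⟩
  ΣFrom 0 (suc n) A + (R 0 + ΣFrom 0 (suc n) P)
    ≡⟨ swap (ΣFrom 0 (suc n) A) (R 0) (ΣFrom 0 (suc n) P) ⟩
  R 0 + (ΣFrom 0 (suc n) A + ΣFrom 0 (suc n) P)
    ≡⟨ cong (_+_ (R 0)) (sym (ΣFrom-distrib-+ 0 (suc n) A P)) ⟩
  R 0 + ΣFrom 0 (suc n) (λ k → A k + P k)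
    ≡⟨ cong (_+_ (R 0)) (ΣFrom-cong 0 (suc n) (λ k _ → pascal k)) ⟩
  R 0 + ΣFrom 0 (suc n) (λ k → ι (suc n C suc k) * (f (suc k) * g (n ∸ k)))
    ≡⟨ cong (_+_ (R 0)) (sym (ΣFrom-shift 0 (suc n) (λ k → ι (suc n C k) * (f k * g (suc n ∸ k))))) ⟩
  ΣFrom 0 (suc (suc n)) (λ k → ι (suc n C k) * (f k * g (suc n ∸ k)))
    ∎
  where
  open ≡-Reasoning
  A R P : ℕ → ℚ
  A k = ι (n C k) * (f (suc k) * g (n ∸ k))
  R k = ι (n C k) * (f k * g (suc (n ∸ k)))
  P k = ι (n C suc k) * (f (suc k) * g (n ∸ k))
  shifted : ∀ k → k < n → R (suc k) ≡ P k
  shifted k k<n = cong (λ m → ι (n C suc k) * (f (suc k) * g m)) (sym (ℕ.+-∸-assoc 1 k<n))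
  P-last : ΣFrom 0 n P ≡ ΣFrom 0 (suc n) P
  P-last = sym (trans (ΣFrom-init-last 0 n P)
    (trans (cong (λ c → ΣFrom 0 n P + ι c * (f (suc n) * g (n ∸ n))) (k>n⇒nCk≡0 (ℕ.n<1+n n)))
           (trans (cong (_+_ (ΣFrom 0 n P)) (*-zeroˡ (f (suc n) * g (n ∸ n)))) (+-identityʳ _))))
  pascal : ∀ k → A k + P k ≡ ι (suc n C suc k) * (f (suc k) * g (n ∸ k))
  pascal k = begin
    A k + P k                                             ≡⟨ sym (*-distribʳ-+ _ (ι (n C k)) (ι (n C suc k))) ⟩
    (ι (n C k) + ι (n C suc k)) * (f (suc k) * g (n ∸ k)) ≡⟨ cong (_* (f (suc k) * g (n ∸ k))) (sym (ι-homo-+ (n C k) (n C suc k))) ⟩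
    ι (n C k ℕ.+ n C suc k) * (f (suc k) * g (n ∸ k))     ≡⟨ cong (λ c → ι c * (f (suc k) * g (n ∸ k))) (nCk+nC[k+1]≡[n+1]C[k+1] n k) ⟩
    ι (suc n C suc k) * (f (suc k) * g (n ∸ k))           ∎
  swap : ∀ a b c → a + (b + c) ≡ b + (a + c)
  swap = solve-∀ ℚ-ring

⋆-exp1 : ∀ f n → (f ⋆ exp 1ℚ) n ≡ ΣFrom 0 (suc n) (λ k → ι (n C k) * f k)
⋆-exp1 f n = trans (⋆-binomial f (exp 1ℚ) n)
  (ΣFrom-cong 0 (suc n) (λ k _ → cong (_*_ (ι (n C k))) (trans (cong (_*_ (f k)) (1^n≡1 (n ∸ k))) (*-identityʳ (f k)))))

-- The coefficient of t^{j+1} in z eᵗ = z reads Σ_{k≤j} C(j+1,k) z k = 0; if z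
-- vanishes below j, this leaves (j + 1) z j = 0.
exp1-fixed⇒0ˢ : ∀ z → z ⋆ exp 1ℚ ≗ z → z ≗ 0ˢ
exp1-fixed⇒0ˢ z fixed = <-rec (λ j → z j ≡ 0ℚ) step
  where
  step : ∀ j → (∀ {k} → k < j → z k ≡ 0ℚ) → z j ≡ 0ℚ
  step j below = *-cancelˡ-ι-suc j (z j) (begin
    ι (suc j) * z j                                          ≡⟨ isolate (ι (suc j) * z j) (z (suc j)) ⟩
    ((0ℚ + ι (suc j) * z j) + 1ℚ * z (suc j)) - z (suc j)    ≡⟨ cong (_- z (suc j)) (sym expand) ⟩
    z (suc j) - z (suc j)                                    ≡⟨ +-inverseʳ (z (suc j)) ⟩
    0ℚ                                                       ∎)
    where
    open ≡-Reasoning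
    E : ℕ → ℚ
    E k = ι (suc j C k) * z k
    lower : ΣFrom 0 j E ≡ 0ℚ
    lower = trans (ΣFrom-cong 0 j (λ k k<j → trans (cong (_*_ (ι (suc j C k))) (below k<j)) (*-zeroʳ (ι (suc j C k)))))
                  (ΣFrom-zero 0 j)
    expand : z (suc j) ≡ (0ℚ + ι (suc j) * z j) + 1ℚ * z (suc j)
    expand = begin
      z (suc j)                        ≡⟨ sym (fixed (suc j)) ⟩
      (z ⋆ exp 1ℚ) (suc j)             ≡⟨ ⋆-exp1 z (suc j) ⟩
      ΣFrom 0 (suc (suc j)) E          ≡⟨ ΣFrom-init-last 0 (suc j) E ⟩
      ΣFrom 0 (suc j) E + E (suc j)    ≡⟨ cong (_+ E (suc j)) (ΣFrom-init-last 0 j E) ⟩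
      (ΣFrom 0 j E + E j) + E (suc j)
        ≡⟨ cong₂ (λ c d → (ΣFrom 0 j E + ι c * z j) + ι d * z (suc j)) ([1+n]Cn≡1+n j) (nCn≡1 (suc j)) ⟩
      (ΣFrom 0 j E + ι (suc j) * z j) + 1ℚ * z (suc j)
        ≡⟨ cong (λ s → (s + ι (suc j) * z j) + 1ℚ * z (suc j)) lower ⟩
      (0ℚ + ι (suc j) * z j) + 1ℚ * z (suc j) ∎
    isolate : ∀ x y → x ≡ ((0ℚ + x) + 1ℚ * y) - y
    isolate = solve-∀ ℚ-ring

-- Bernoulli numbers

-- Defs keeps the helper functions of B and bernList private. Each
-- metavariable below is solved by unification to one of them, after which
-- they can be reasoned about through their defining equations.
mutual
  lastᴮ : ℕ → List ℚ → ℚ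
  lastᴮ = _

  nextᴮ : List ℚ → ℚ
  nextᴮ = _

  tailSumᴮ : ℚ → List ℚ → ℚ
  tailSumᴮ = _

  sumᴮ : List ℚ → ℕ → List ℚ → ℚ
  sumᴮ = _

  B≡lastᴮ : ∀ m → B m ≡ lastᴮ m (bernList m)
  B≡lastᴮ m with bernList m
  ... | bs = refl

  bernList-suc : ∀ m → bernList (suc m) ≡ bernList m ++ nextᴮ (bernList m) ∷ []
  bernList-suc m with bernList m
  ... | bs = refl

  nextᴮ-∷ : ∀ b bs → nextᴮ (b ∷ bs) ≡
    - ((+ 1 ℚ./ suc (suc (length bs))) * (ι (suc (suc (length bs)) C 0) * b + tailSumᴮ b bs))
  nextᴮ-∷ b bs = refl

  tailSumᴮ≡sumᴮ : ∀ b bs → tailSumᴮ b bs ≡ sumᴮ (b ∷ bs) 1 bs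
  tailSumᴮ≡sumᴮ b bs with b ∷ bs | 1
  ... | ps | k = refl

lastᴮ-snoc : ∀ m xs y → lastᴮ m (xs ++ y ∷ []) ≡ y
lastᴮ-snoc m []           y = refl
lastᴮ-snoc m (x ∷ [])     y = refl
lastᴮ-snoc m (x ∷ x′ ∷ xs) y = lastᴮ-snoc m (x′ ∷ xs) y

bernoullis : ℕ → ℕ → List ℚ
bernoullis k zero    = []
bernoullis k (suc n) = B k ∷ bernoullis (suc k) n

bernoullis-snoc : ∀ k n → bernoullis k (suc n) ≡ bernoullis k n ++ B (k ℕ.+ n) ∷ []
bernoullis-snoc k zero    = cong (λ i → B i ∷ []) (sym (ℕ.+-identityʳ k))
bernoullis-snoc k (suc n) = cong (B k ∷_)
  (trans (bernoullis-snoc (suc k) n) (cong (λ i → bernoullis (suc k) n ++ B i ∷ []) (sym (ℕ.+-suc k n))))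

length-bernoullis : ∀ k n → length (bernoullis k n) ≡ n
length-bernoullis k zero    = refl
length-bernoullis k (suc n) = cong suc (length-bernoullis (suc k) n)

sumᴮ-bernoullis : ∀ ps k n → sumᴮ ps k (bernoullis k n) ≡ ΣFrom k n (λ j → ι (suc (length ps) C j) * B j)
sumᴮ-bernoullis ps k zero    = refl
sumᴮ-bernoullis ps k (suc n) = cong (_+_ (ι (suc (length ps) C k) * B k)) (sumᴮ-bernoullis ps (suc k) n)

B-suc : ∀ m → B (suc m) ≡ nextᴮ (bernList m)
B-suc m = trans (B≡lastᴮ (suc m))
  (trans (cong (lastᴮ (suc m)) (bernList-suc m)) (lastᴮ-snoc (suc m) (bernList m) (nextᴮ (bernList m))))

bernList≡bernoullis : ∀ m → bernList m ≡ bernoullis 0 (suc m)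
bernList≡bernoullis zero    = refl
bernList≡bernoullis (suc m) = begin
  bernList (suc m)                          ≡⟨ bernList-suc m ⟩
  bernList m ++ nextᴮ (bernList m) ∷ []     ≡⟨ cong₂ (λ bs b → bs ++ b ∷ []) (bernList≡bernoullis m) (sym (B-suc m)) ⟩
  bernoullis 0 (suc m) ++ B (suc m) ∷ []    ≡⟨ sym (bernoullis-snoc 0 (suc m)) ⟩
  bernoullis 0 (suc (suc m))                ∎
  where open ≡-Reasoning

B-recurrence : ∀ m → B (suc m) ≡ - ((+ 1 ℚ./ suc (suc m)) * ΣFrom 0 (suc m) (λ k → ι (suc (suc m) C k) * B k))
B-recurrence m = begin
  B (suc m)                           ≡⟨ B-suc m ⟩
  nextᴮ (bernList m)                  ≡⟨ cong nextᴮ (bernList≡bernoullis m) ⟩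
  nextᴮ (B 0 ∷ bs)                    ≡⟨ nextᴮ-∷ (B 0) bs ⟩
  - ((+ 1 ℚ./ suc (suc (length bs))) * (ι (suc (suc (length bs)) C 0) * B 0 + tailSumᴮ (B 0) bs))
    ≡⟨ cong (λ s → - ((+ 1 ℚ./ suc (suc (length bs))) * (ι (suc (suc (length bs)) C 0) * B 0 + s)))
            (trans (tailSumᴮ≡sumᴮ (B 0) bs) (sumᴮ-bernoullis (B 0 ∷ bs) 1 m)) ⟩
  shape (length bs)                   ≡⟨ cong shape (length-bernoullis 1 m) ⟩
  shape m                             ∎
  where
  open ≡-Reasoning
  bs = bernoullis 1 m
  shape : ℕ → ℚ
  shape l = - ((+ 1 ℚ./ suc (suc l)) * ΣFrom 0 (suc m) (λ k → ι (suc (suc l) C k) * B k))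

B-1 : B 1 ≡ - ½
B-1 = refl

bernoulli-binomial-sum : ∀ m → ΣFrom 0 (suc (suc m)) (λ k → ι (suc (suc m) C k) * B k) ≡ 0ℚ
bernoulli-binomial-sum m = begin
  ΣFrom 0 (suc (suc m)) F                     ≡⟨ ΣFrom-init-last 0 (suc m) F ⟩
  s + ι (suc (suc m) C suc m) * B (suc m)     ≡⟨ cong₂ (λ c b → s + ι c * b) ([1+n]Cn≡1+n (suc m)) (B-recurrence m) ⟩
  s + ι (suc (suc m)) * - (h * s)             ≡⟨ cancel s (ι (suc (suc m))) h ⟩
  s - (ι (suc (suc m)) * h) * s               ≡⟨ cong (λ c → s - c * s) (ι-*-inverse (suc m)) ⟩
  s - 1ℚ * s                                  ≡⟨ cong (_-_ s) (*-identityˡ s) ⟩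
  s - s                                       ≡⟨ +-inverseʳ s ⟩
  0ℚ                                          ∎
  where
  open ≡-Reasoning
  F : ℕ → ℚ
  F k = ι (suc (suc m) C k) * B k
  s = ΣFrom 0 (suc m) F
  h = + 1 ℚ./ suc (suc m)
  cancel : ∀ s a h → s + a * - (h * s) ≡ s - (a * h) * s
  cancel = solve-∀ ℚ-ring

B⋆exp1≗B⊕δ₁ : B ⋆ exp 1ℚ ≗ B ⊕ δ₁
B⋆exp1≗B⊕δ₁ zero          = refl
B⋆exp1≗B⊕δ₁ (suc zero)    = refl
B⋆exp1≗B⊕δ₁ (suc (suc m)) = begin
  (B ⋆ exp 1ℚ) (suc (suc m))                                    ≡⟨ ⋆-exp1 B (suc (suc m)) ⟩
  ΣFrom 0 (suc (suc (suc m))) F                                 ≡⟨ ΣFrom-init-last 0 (suc (suc m)) F ⟩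
  ΣFrom 0 (suc (suc m)) F + ι (suc (suc m) C suc (suc m)) * B (suc (suc m))
    ≡⟨ cong₂ (λ s c → s + ι c * B (suc (suc m))) (bernoulli-binomial-sum m) (nCn≡1 (suc (suc m))) ⟩
  0ℚ + 1ℚ * B (suc (suc m))                                     ≡⟨ trans (+-identityˡ _) (*-identityˡ _) ⟩
  B (suc (suc m))                                               ≡⟨ sym (+-identityʳ _) ⟩
  B (suc (suc m)) + 0ℚ                                          ∎
  where
  open ≡-Reasoning
  F : ℕ → ℚ
  F k = ι (suc (suc m) C k) * B k

dilate-B⋆exp-1 : dilate (- 1ℚ) B ⋆ exp (- 1ℚ) ≗ dilate (- 1ℚ) B ⊖ δ₁
dilate-B⋆exp-1 k = begin
  (β ⋆ exp (- 1ℚ)) k                 ≡⟨ ⋆-cong (λ _ → refl) (exp≗dilate-exp1 (- 1ℚ)) k ⟩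
  (β ⋆ dilate (- 1ℚ) (exp 1ℚ)) k     ≡⟨ dilate-⋆ (- 1ℚ) B (exp 1ℚ) k ⟩
  (- 1ℚ) ^ k * (B ⋆ exp 1ℚ) k        ≡⟨ cong (_*_ ((- 1ℚ) ^ k)) (B⋆exp1≗B⊕δ₁ k) ⟩
  (- 1ℚ) ^ k * (B k + δ₁ k)          ≡⟨ *-distribˡ-+ ((- 1ℚ) ^ k) (B k) (δ₁ k) ⟩
  β k + (- 1ℚ) ^ k * δ₁ k            ≡⟨ cong (_+_ (β k)) (dilate-δ₁ k) ⟩
  β k - δ₁ k                         ∎
  where
  open ≡-Reasoning
  β = dilate (- 1ℚ) B

B-reflection : dilate (- 1ℚ) B ≗ B ⊕ δ₁
B-reflection k = begin
  β k                                    ≡⟨ rearrange (β k) (δ₁ k) (B k) ⟩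
  ((β k - δ₁ k) - B k) + (B k + δ₁ k)    ≡⟨ cong (_+ (B k + δ₁ k)) (exp1-fixed⇒0ˢ z z-fixed k) ⟩
  0ℚ + (B k + δ₁ k)                      ≡⟨ +-identityˡ (B k + δ₁ k) ⟩
  B k + δ₁ k                             ∎
  where
  open ≡-Reasoning
  β z : Seq
  β = dilate (- 1ℚ) B
  z = (β ⊖ δ₁) ⊖ B
  rearrange : ∀ x y w → x ≡ ((x - y) - w) + (w + y)
  rearrange = solve-∀ ℚ-ring
  regroup : ∀ x y w → x - (y + w) ≡ (x - w) - y
  regroup = solve-∀ ℚ-ring
  z-fixed : z ⋆ exp 1ℚ ≗ z
  z-fixed j = begin
    (z ⋆ exp 1ℚ) j                            ≡⟨ ⋆-distribʳ-⊖ (β ⊖ δ₁) B (exp 1ℚ) j ⟩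
    ((β ⊖ δ₁) ⋆ exp 1ℚ) j - (B ⋆ exp 1ℚ) j
      ≡⟨ cong₂ _-_ (sym (⋆-cong dilate-B⋆exp-1 (λ _ → refl) j)) (B⋆exp1≗B⊕δ₁ j) ⟩
    (β ⋆ exp (- 1ℚ) ⋆ exp 1ℚ) j - (B j + δ₁ j) ≡⟨ cong (_- (B j + δ₁ j)) (⋆-exp-cancel 1ℚ β j) ⟩
    β j - (B j + δ₁ j)                        ≡⟨ regroup (β j) (B j) (δ₁ j) ⟩
    z j                                       ∎

B-odd : ∀ i → B (suc (2 ℕ.* suc i)) ≡ 0ℚ
B-odd i = begin
  b                                 ≡⟨ halve b ⟩
  - ½ * ((- 1ℚ * b) - (b + 0ℚ))     ≡⟨ cong (λ u → - ½ * (u * b - (b + 0ℚ))) (sym (-1^[1+2n]≡-1 (suc i))) ⟩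
  - ½ * (β k - (b + 0ℚ))            ≡⟨ cong (λ u → - ½ * (u - (b + 0ℚ))) (B-reflection k) ⟩
  - ½ * ((b + 0ℚ) - (b + 0ℚ))       ≡⟨ cong (_*_ (- ½)) (+-inverseʳ (b + 0ℚ)) ⟩
  - ½ * 0ℚ                          ≡⟨ *-zeroʳ (- ½) ⟩
  0ℚ                                ∎
  where
  open ≡-Reasoning
  k = suc (2 ℕ.* suc i)
  b = B k
  β = dilate (- 1ℚ) B
  halve : ∀ b → b ≡ - ½ * ((- 1ℚ * b) - (b + 0ℚ))
  halve = solve-∀ ℚ-ring

-- Power sums

faulhaber-step : ∀ r y → (B ⋆ exp (1ℚ + y)) (suc r) ≡ (B ⋆ exp y) (suc r) + ι (suc r) * y ^ r
faulhaber-step r y = begin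
  (B ⋆ exp (1ℚ + y)) (suc r)                   ≡⟨ ⋆-cong (λ _ → refl) (λ k → sym (exp-⋆ 1ℚ y k)) (suc r) ⟩
  (B ⋆ (exp 1ℚ ⋆ exp y)) (suc r)               ≡⟨ sym (⋆-assoc B (exp 1ℚ) (exp y) (suc r)) ⟩
  (B ⋆ exp 1ℚ ⋆ exp y) (suc r)                 ≡⟨ ⋆-cong B⋆exp1≗B⊕δ₁ (λ _ → refl) (suc r) ⟩
  ((B ⊕ δ₁) ⋆ exp y) (suc r)                   ≡⟨ ⋆-distribʳ-⊕ B δ₁ (exp y) (suc r) ⟩
  (B ⋆ exp y) (suc r) + (δ₁ ⋆ exp y) (suc r)   ≡⟨ cong (_+_ ((B ⋆ exp y) (suc r))) (δ₁-⋆ (exp y) r) ⟩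
  (B ⋆ exp y) (suc r) + ι (suc r) * y ^ r      ∎
  where open ≡-Reasoning

faulhaber : ∀ r n → ι (suc r) * ΣFrom 0 n (λ i → ι (i ℕ.^ r)) ≡ (B ⋆ exp (ι n)) (suc r) - B (suc r)
faulhaber r zero = begin
  ι (suc r) * 0ℚ                     ≡⟨ *-zeroʳ (ι (suc r)) ⟩
  0ℚ                                 ≡⟨ sym (+-inverseʳ (B (suc r))) ⟩
  B (suc r) - B (suc r)              ≡⟨ cong (_- B (suc r)) (sym (trans (⋆-cong (λ _ → refl) exp-0 (suc r)) (⋆-identityʳ B (suc r)))) ⟩
  (B ⋆ exp 0ℚ) (suc r) - B (suc r)   ∎
  where open ≡-Reasoning
faulhaber r (suc n) = begin
  ι (suc r) * ΣFrom 0 (suc n) p                        ≡⟨ cong (_*_ (ι (suc r))) (ΣFrom-init-last 0 n p) ⟩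
  ι (suc r) * (ΣFrom 0 n p + ι (n ℕ.^ r))              ≡⟨ *-distribˡ-+ (ι (suc r)) (ΣFrom 0 n p) (ι (n ℕ.^ r)) ⟩
  ι (suc r) * ΣFrom 0 n p + ι (suc r) * ι (n ℕ.^ r)    ≡⟨ cong₂ _+_ (faulhaber r n) (cong (_*_ (ι (suc r))) (ι-homo-^ n r)) ⟩
  (F (ι n) - B (suc r)) + ι (suc r) * ι n ^ r          ≡⟨ swap (F (ι n)) (B (suc r)) (ι (suc r) * ι n ^ r) ⟩
  (F (ι n) + ι (suc r) * ι n ^ r) - B (suc r)          ≡⟨ cong (_- B (suc r)) (sym (faulhaber-step r (ι n))) ⟩
  F (1ℚ + ι n) - B (suc r)                             ≡⟨ cong (λ y → F y - B (suc r)) (sym (ι-suc n)) ⟩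
  F (ι (suc n)) - B (suc r)                            ∎
  where
  open ≡-Reasoning
  p : ℕ → ℚ
  p i = ι (i ℕ.^ r)
  F : ℚ → ℚ
  F y = (B ⋆ exp y) (suc r)
  swap : ∀ x y w → (x - y) + w ≡ (x + w) - y
  swap = solve-∀ ℚ-ring

S-suc : ∀ n k → S (suc n) k ≡ S n k + ι (suc n) ^ k
S-suc n k = trans (ΣFrom-init-last 1 n (λ i → ι (i ℕ.^ k))) (cong (_+_ (S n k)) (ι-homo-^ (suc n) k))

module OddPowerSums (r′ : ℕ) where

  r N a : ℕ
  r = suc r′
  N = suc r
  a = 2 ℕ.* r ℕ.+ 1

  middleTerms : ℚ → ℚ
  middleTerms y = ΣFrom 2 r′ (λ k → ι (N C k) * (B k * y ^ (N ∸ k)))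

  correction : ℕ → ℚ
  correction n = ΣFrom 2 r′ (λ k → B k * (ι (N C k) * S n (a ∸ k)))

  faulhaber-expansion : ∀ y → (B ⋆ exp y) N ≡ y ^ N + (ι N * (- ½ * y ^ r) + (middleTerms y + B N))
  faulhaber-expansion y = begin
    (B ⋆ exp y) N                                ≡⟨ ⋆-binomial B (exp y) N ⟩
    t 0 + (t 1 + ΣFrom 2 (suc r′) t)             ≡⟨ cong (λ s → t 0 + (t 1 + s)) (ΣFrom-init-last 2 r′ t) ⟩
    t 0 + (t 1 + (middleTerms y + t N))          ≡⟨ cong₂ (λ u v → u + (t 1 + (middleTerms y + v))) first last ⟩
    y ^ N + (t 1 + (middleTerms y + B N))
      ≡⟨ cong₂ (λ c b → y ^ N + (ι c * (b * y ^ r) + (middleTerms y + B N))) (nC1≡n N) B-1 ⟩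
    y ^ N + (ι N * (- ½ * y ^ r) + (middleTerms y + B N)) ∎
    where
    open ≡-Reasoning
    t : ℕ → ℚ
    t k = ι (N C k) * (B k * y ^ (N ∸ k))
    -- N C 0 and B 0 both compute to 1.
    first : t 0 ≡ y ^ N
    first = trans (*-identityˡ (1ℚ * y ^ N)) (*-identityˡ (y ^ N))
    last : t N ≡ B N
    last = trans (cong₂ (λ c e → ι c * (B N * y ^ e)) (nCn≡1 N) (ℕ.n∸n≡0 N))
                 (trans (*-identityˡ (B N * 1ℚ)) (*-identityʳ (B N)))

  -- The i = 0 term of the sum in faulhaber is ι (0 ^ r), which computes to 0ℚ as r ≥ 1.
  faulhaber-S : ∀ n → ι N * S n r ≡ (B ⋆ exp (ι (suc n))) N - B N
  faulhaber-S n = trans (cong (_*_ (ι N)) (sym (+-identityˡ (S n r)))) (faulhaber r (suc n))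

  a≡r+N : a ≡ r ℕ.+ N
  a≡r+N = arith r′
    where
    arith : ∀ m → 2 ℕ.* suc m ℕ.+ 1 ≡ suc m ℕ.+ suc (suc m)
    arith = ℕ-Solver.solve-∀

  a∸k≡r+[N∸k] : ∀ {k} → k ℕ.≤ N → a ∸ k ≡ r ℕ.+ (N ∸ k)
  a∸k≡r+[N∸k] {k} k≤N = trans (cong (_∸ k) a≡r+N) (ℕ.+-∸-assoc r k≤N)

  correction-suc : ∀ n → correction (suc n) ≡ correction n + ι (suc n) ^ r * middleTerms (ι (suc n))
  correction-suc n = begin
    correction (suc n)
      ≡⟨ ΣFrom-cong 2 r′ (λ i i<r′ → split (2 ℕ.+ i) (s≤s (s≤s (ℕ.<⇒≤ i<r′)))) ⟩
    ΣFrom 2 r′ (λ k → B k * (ι (N C k) * S n (a ∸ k)) + P * (ι (N C k) * (B k * M ^ (N ∸ k))))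
      ≡⟨ ΣFrom-distrib-+ 2 r′ _ _ ⟩
    correction n + ΣFrom 2 r′ (λ k → P * (ι (N C k) * (B k * M ^ (N ∸ k))))
      ≡⟨ cong (_+_ (correction n)) (*-distribˡ-ΣFrom P 2 r′ (λ k → ι (N C k) * (B k * M ^ (N ∸ k)))) ⟩
    correction n + P * middleTerms M ∎
    where
    open ≡-Reasoning
    M = ι (suc n)
    P = M ^ r
    distribute : ∀ b c s p q → b * (c * (s + p * q)) ≡ b * (c * s) + p * (c * (b * q))
    distribute = solve-∀ ℚ-ring
    split : ∀ k → k ℕ.≤ N →
      B k * (ι (N C k) * S (suc n) (a ∸ k)) ≡ B k * (ι (N C k) * S n (a ∸ k)) + P * (ι (N C k) * (B k * M ^ (N ∸ k)))
    split k k≤N = begin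
      B k * (ι (N C k) * S (suc n) (a ∸ k))              ≡⟨ cong (λ s → B k * (ι (N C k) * s)) (S-suc n (a ∸ k)) ⟩
      B k * (ι (N C k) * (S n (a ∸ k) + M ^ (a ∸ k)))    ≡⟨ cong (λ e → B k * (ι (N C k) * (S n (a ∸ k) + M ^ e))) (a∸k≡r+[N∸k] k≤N) ⟩
      B k * (ι (N C k) * (S n (a ∸ k) + M ^ (r ℕ.+ (N ∸ k))))
        ≡⟨ cong (λ m → B k * (ι (N C k) * (S n (a ∸ k) + m))) (^-homo-* M r (N ∸ k)) ⟩
      B k * (ι (N C k) * (S n (a ∸ k) + P * M ^ (N ∸ k)))
        ≡⟨ distribute (B k) (ι (N C k)) (S n (a ∸ k)) P (M ^ (N ∸ k)) ⟩
      B k * (ι (N C k) * S n (a ∸ k)) + P * (ι (N C k) * (B k * M ^ (N ∸ k))) ∎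

  correction-zero : correction 0 ≡ 0ℚ
  correction-zero = trans (ΣFrom-cong 2 r′ (λ i _ → trans (cong (_*_ (B (2 ℕ.+ i))) (*-zeroʳ (ι (N C (2 ℕ.+ i))))) (*-zeroʳ (B (2 ℕ.+ i)))))
                          (ΣFrom-zero 2 r′)

  middleTerms-faulhaber : ∀ n → middleTerms (ι (suc n)) ≡ (ι N * S n r - ι (suc n) ^ N) - ι N * (- ½ * ι (suc n) ^ r)
  middleTerms-faulhaber n = begin
    m                                        ≡⟨ isolate e t m (B N) ⟩
    (((e + (t + (m + B N))) - B N) - e) - t  ≡⟨ cong (λ x → ((x - B N) - e) - t) (sym (faulhaber-expansion M)) ⟩
    (((B ⋆ exp M) N - B N) - e) - t          ≡⟨ cong (λ x → (x - e) - t) (sym (faulhaber-S n)) ⟩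
    (ι N * S n r - e) - t                    ∎
    where
    open ≡-Reasoning
    M = ι (suc n)
    m = middleTerms M
    e = M ^ N
    t = ι N * (- ½ * M ^ r)
    isolate : ∀ e t m b → m ≡ (((e + (t + (m + b))) - b) - e) - t
    isolate = solve-∀ ℚ-ring

  odd-power-identity : ∀ n → S n a ≡ (ι N * ½) * (S n r * S n r) - correction n
  odd-power-identity zero = begin
    0ℚ                                        ≡⟨ vanish (ι N) ⟩
    (ι N * ½) * (0ℚ * 0ℚ) - 0ℚ                ≡⟨ cong (λ s → (ι N * ½) * (0ℚ * 0ℚ) - s) (sym correction-zero) ⟩
    (ι N * ½) * (0ℚ * 0ℚ) - correction 0      ∎
    where
    open ≡-Reasoning
    vanish : ∀ x → 0ℚ ≡ (x * ½) * (0ℚ * 0ℚ) - 0ℚ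
    vanish = solve-∀ ℚ-ring
  odd-power-identity (suc n) = begin
    S (suc n) a                                         ≡⟨ S-suc n a ⟩
    S n a + M ^ a                                       ≡⟨ cong₂ _+_ (odd-power-identity n) (trans (cong (M ^_) a≡r+N) (^-homo-* M r N)) ⟩
    ((ι N * ½) * (T * T) - G) + P * M ^ N               ≡⟨ complete-square (ι N) T P G (M ^ N) ⟩
    (ι N * ½) * ((T + P) * (T + P)) - (G + P * ((ι N * T - M ^ N) - ι N * (- ½ * P)))
      ≡⟨ cong (λ s → (ι N * ½) * ((T + P) * (T + P)) - (G + P * s)) (sym (middleTerms-faulhaber n)) ⟩
    (ι N * ½) * ((T + P) * (T + P)) - (G + P * middleTerms M)
      ≡⟨ cong₂ (λ u v → (ι N * ½) * (u * u) - v) (sym (S-suc n r)) (sym (correction-suc n)) ⟩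
    (ι N * ½) * (S (suc n) r * S (suc n) r) - correction (suc n) ∎
    where
    open ≡-Reasoning
    M = ι (suc n)
    P = M ^ r
    T = S n r
    G = correction n
    complete-square : ∀ x T P G e →
      ((x * ½) * (T * T) - G) + P * e ≡ (x * ½) * ((T + P) * (T + P)) - (G + P * ((x * T - e) - x * (- ½ * P)))
    complete-square = solve-∀ ℚ-ring

mainTheorem1 : (n r : ℕ) → n ≥ 1 → r ≥ 1 →
    S n (2 ℕ.* r ℕ.+ 1)
      ≡ ((+ (r ℕ.+ 1)) ℚ./ 2) * (S n r * S n r)
        - ΣFrom 1 (r / 2) (λ j → B (2 ℕ.* j) * (ι ((r ℕ.+ 1) C (2 ℕ.* j)) * S n (2 ℕ.* r ℕ.+ 1 ℕ.∸ 2 ℕ.* j)))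
mainTheorem1 n zero     _ ()
mainTheorem1 n (suc r′) _ _ =
  trans (odd-power-identity n) (cong₂ (λ c s → c * (S n r * S n r) - s) coefficient reindex)
  where
  open OddPowerSums r′
  term : ℕ → ℕ → ℚ
  term M k = B k * (ι (M C k) * S n (a ∸ k))
  coefficient : ι N * ½ ≡ + (r ℕ.+ 1) ℚ./ 2
  coefficient = sym (trans (cong (λ m → + m ℚ./ 2) (ℕ.+-comm r 1)) (/2≡*½ N))
  term-odd : ∀ i → term (r ℕ.+ 1) (suc (2 ℕ.* suc i)) ≡ 0ℚ
  term-odd i = trans (cong (_* rest) (B-odd i)) (*-zeroˡ rest)
    where
    k = suc (2 ℕ.* suc i)
    rest = ι ((r ℕ.+ 1) C k) * S n (a ∸ k)
  reindex : correction n ≡ ΣFrom 1 (r / 2) (λ j → term (r ℕ.+ 1) (2 ℕ.* j))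
  reindex = trans (cong (λ M → ΣFrom 2 r′ (term M)) (ℕ.+-comm 1 r))
                  (ΣFrom-evens (term (r ℕ.+ 1)) term-odd r′)
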